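{- Let $k$ be an integer and let $n$ be an integer with $n > \max(k,0)$. Then $a^{n-k+1} \equiv a \pmod{n}$ holds for all integers $a$ if and only if $n$ is squarefree and $p-1$ divides $n-k$ for every prime factor $p$ of $n$. -}

module Defs where

open import Data.Nat using (ℕ; _*_; _<_)
open import Data.Nat.Divisibility using (_∣_)
open import Relation.Nullary using (¬_)

SquareFree : ℕ → Set
SquareFree n = ∀ d → 1 < d → ¬ (d * d ∣ n)

-- Write m = n - k ≥ 1. For a prime p, a ^ (m + 1) ≡ a (mod p) holds for all a iff p - 1 ∣ m.
-- If p - 1 ∣ m this is Fermat's little theorem, proved from the binomial theorem since p
-- divides the inner binomial coefficients p C k. Conversely, if r = m mod (p - 1) were
-- non-zero, Fermat would give a ^ r ≡ 1 for every unit a, so x ^ r - 1 would have the r + 1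
-- roots 1, …, r + 1 modulo p, too many for a polynomial of degree r < p (Lagrange).
-- Taking a = d rules out d * d ∣ n for d > 1, and for squarefree n the congruences modulo
-- the prime factors of n combine into one modulo n.
module Submission where

open import Data.Empty using (⊥-elim)
open import Data.Product using (_×_; _,_; ∃-syntax)
open import Data.Sum using (_⊎_; inj₁; inj₂; [_,_]′)
open import Function using (_∘_)
open import Relation.Binary.PropositionalEquality
open import Relation.Nullary using (¬_; yes; no)

module FreshmansDream where

  open import Data.Nat
  open import Data.Nat.Properties
  open import Data.Nat.Divisibility
  open import Data.Nat.Primality using (Prime; euclidsLemma; ¬prime[1])
  open import Data.Nat.Combinatorics using (_C_; nCk≡n!/k![n-k]!; k![n∸k]!∣n!; nCn≡1)
  open import Data.Nat.DivMod using (m/n*n≡m)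
  open import Data.Fin as Fin using (Fin; toℕ; fromℕ; inject₁)
  import Data.Fin.Properties as Fin
  open import Data.Vec.Functional using (Vector; init; last)
  open import Algebra.Properties.CommutativeSemiring.Binomial +-*-commutativeSemiring
    using (theorem; binomialTerm)
  import Algebra.Properties.Semiring.Exp +-*-semiring as Semiring
  open import Algebra.Definitions.RawMonoid +-0-rawMonoid using (sum) renaming (_×_ to _·_)
  open import Algebra.Properties.Monoid.Sum +-0-monoid using (sum-init-last)

  prime∤! : ∀ {p k} → Prime p → k < p → ¬ (p ∣ k !)
  prime∤! {k = zero}  pr _   p∣1 = ¬prime[1] (subst Prime (∣1⇒≡1 p∣1) pr)
  prime∤! {k = suc k} pr k<p p∣k! with euclidsLemma (suc k) (k !) pr p∣k!
  ... | inj₁ p∣1+k = >⇒∤ k<p p∣1+k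
  ... | inj₂ p∣k!′ = prime∤! pr (<-trans (n<1+n k) k<p) p∣k!′

  nCk*k![n∸k]!≡n! : ∀ {n k} → k ≤ n → (n C k) * (k ! * (n ∸ k) !) ≡ n !
  nCk*k![n∸k]!≡n! {n} {k} k≤n = trans
    (cong (_* (k ! * (n ∸ k) !)) (nCk≡n!/k![n-k]! k≤n))
    (m/n*n≡m {{k !* (n ∸ k) !≢0}} (k![n∸k]!∣n! k≤n))

  -- p divides p! but neither k! nor (p ∸ k)!.
  prime∣C : ∀ {p k} → Prime p → 0 < k → k < p → p ∣ p C k
  prime∣C {suc q} {k} pr 0<k k<p
    with euclidsLemma (suc q C k) (k ! * (suc q ∸ k) !) pr
           (subst (suc q ∣_) (sym (nCk*k![n∸k]!≡n! (<⇒≤ k<p))) (m∣m*n (q !)))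
  ... | inj₁ p∣pCk = p∣pCk
  ... | inj₂ p∣k![p∸k]! with euclidsLemma (k !) ((suc q ∸ k) !) pr p∣k![p∸k]!
  ...   | inj₁ p∣k!     = ⊥-elim (prime∤! pr k<p p∣k!)
  ...   | inj₂ p∣[p∸k]! = ⊥-elim (prime∤! pr (∸-monoʳ-< 0<k (<⇒≤ k<p)) p∣[p∸k]!)

  semiring-^≡^ : ∀ x n → x Semiring.^ n ≡ x ^ n
  semiring-^≡^ x zero    = refl
  semiring-^≡^ x (suc n) = cong (x *_) (semiring-^≡^ x n)

  ·≡* : ∀ n x → n · x ≡ n * x
  ·≡* zero    x = refl
  ·≡* (suc n) x = cong (x +_) (·≡* n x)

  ∣-sum : ∀ {d n} (t : Vector ℕ n) → (∀ i → d ∣ t i) → d ∣ sum t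
  ∣-sum {d} {zero}  t d∣t = d ∣0
  ∣-sum {d} {suc n} t d∣t = ∣m∣n⇒∣m+n (d∣t Fin.zero) (∣-sum (t ∘ Fin.suc) (d∣t ∘ Fin.suc))

  module _ (x y : ℕ) where

    binomialTerm-first : ∀ n → binomialTerm x y n Fin.zero ≡ y ^ n
    binomialTerm-first n = begin
      1 · (1 * y Semiring.^ n) ≡⟨ ·≡* 1 _ ⟩
      1 * (1 * y Semiring.^ n) ≡⟨ *-identityˡ _ ⟩
      1 * y Semiring.^ n       ≡⟨ *-identityˡ _ ⟩
      y Semiring.^ n           ≡⟨ semiring-^≡^ y n ⟩
      y ^ n                    ∎
      where open ≡-Reasoning

    binomialTerm-last : ∀ n → binomialTerm x y n (fromℕ n) ≡ x ^ n
    binomialTerm-last n = begin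
      (n C toℕ (fromℕ n)) · (x Semiring.^ toℕ (fromℕ n) * y Semiring.^ (n ∸ toℕ (fromℕ n)))
        ≡⟨ cong (λ k → (n C k) · (x Semiring.^ k * y Semiring.^ (n ∸ k))) (Fin.toℕ-fromℕ n) ⟩
      (n C n) · (x Semiring.^ n * y Semiring.^ (n ∸ n))
        ≡⟨ cong₂ (λ c k → c · (x Semiring.^ n * y Semiring.^ k)) (nCn≡1 n) (n∸n≡0 n) ⟩
      1 · (x Semiring.^ n * 1)
        ≡⟨ trans (·≡* 1 _) (trans (*-identityˡ _) (*-identityʳ _)) ⟩
      x Semiring.^ n
        ≡⟨ semiring-^≡^ x n ⟩
      x ^ n ∎
      where open ≡-Reasoning

    prime∣binomialTerm : ∀ {q} → Prime (suc q) → (i : Fin q) →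
                         suc q ∣ binomialTerm x y (suc q) (Fin.suc (inject₁ i))
    prime∣binomialTerm {q} pr i = subst (suc q ∣_) (sym (·≡* (suc q C suc k) _))
      (∣m⇒∣m*n _ (prime∣C pr z<s (s≤s k<q)))
      where
      k = toℕ (inject₁ i)
      k<q : k < q
      k<q = subst (_< q) (sym (Fin.toℕ-inject₁ i)) (Fin.toℕ<n i)

  freshmansDream : ∀ {p} → Prime p → ∀ x y → ∃[ s ] p ∣ s × (x + y) ^ p ≡ y ^ p + (s + x ^ p)
  freshmansDream {suc q} pr x y =
    sum (init middle) , ∣-sum (init middle) (prime∣binomialTerm x y pr) , expansion
    where
    terms : Vector ℕ (suc (suc q))
    terms = binomialTerm x y (suc q)
    middle : Vector ℕ (suc q)
    middle = terms ∘ Fin.suc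
    expansion : (x + y) ^ suc q ≡ y ^ suc q + (sum (init middle) + x ^ suc q)
    expansion = begin
      (x + y) ^ suc q
        ≡⟨ semiring-^≡^ (x + y) (suc q) ⟨
      (x + y) Semiring.^ suc q
        ≡⟨ theorem (suc q) x y ⟩
      terms Fin.zero + sum middle
        ≡⟨ cong₂ _+_ (binomialTerm-first x y (suc q)) (sum-init-last middle) ⟩
      y ^ suc q + (sum (init middle) + last middle)
        ≡⟨ cong (λ t → y ^ suc q + (sum (init middle) + t)) (binomialTerm-last x y (suc q)) ⟩
      y ^ suc q + (sum (init middle) + x ^ suc q) ∎
      where open ≡-Reasoning

open import Data.Integer
  using (ℤ; +_; 0ℤ; 1ℤ; -1ℤ; _+_; _*_; _-_; -_; _^_; ∣_∣; _%_; _/_; _<_; NonZero)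
open import Data.Integer.DivMod using (a≡a%n+[a/n]*n)
open import Data.Integer.Divisibility using () renaming (_∣_ to _∣ᵤ_)
open import Data.Integer.Divisibility.Signed
open import Data.Integer.Properties
  using ( +-identityˡ; +-identityʳ; +-inverseʳ; *-identityʳ; *-assoc; *-comm
        ; ^-zeroˡ; ^-*-assoc; ^-distribˡ-+-*; pos-*; abs-*; ∣i∣≡0⇒i≡0; i-j≡0⇒i≡j; <-irrefl)
open import Data.Integer.Tactic.RingSolver using (solve-∀)
open import Data.List.Relation.Unary.All using (All; []; _∷_)
open import Data.List using (_∷_; [])
open import Data.Nat as ℕ using (ℕ; zero; suc; z≤n; s≤s; z<s)
import Data.Nat.Divisibility as ℕ
open import Data.Nat.DivMod as ℕ using ()
open import Data.Nat.ListAction using (product)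
open import Data.Nat.Primality using (Prime; euclidsLemma; prime⇒nonTrivial)
open import Data.Nat.Primality.Factorisation using (PrimeFactorisation; factorise)
import Data.Nat.Properties as ℕ
open import Data.Vec using (Vec; []; _∷_; last)
open import Function.Bundles using (_⇔_; mk⇔)
open import Level using (0ℓ)
open import Relation.Binary.Bundles using (Setoid)
import Relation.Binary.Reasoning.Setoid
open import Defs

open FreshmansDream using (freshmansDream)

infix 4 _≡_mod_
record _≡_mod_ (a b m : ℤ) : Set where
  constructor ≡mod
  field
    ∣-difference : m ∣ a - b
open _≡_mod_ public

module _ {m : ℤ} where

  ≡mod-refl : ∀ {a} → a ≡ a mod m
  ≡mod-refl {a} = ≡mod (divides 0ℤ (+-inverseʳ a))

  ≡mod-sym : ∀ {a b} → a ≡ b mod m → b ≡ a mod m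
  ≡mod-sym {a} {b} (≡mod m∣a-b) = ≡mod (subst (m ∣_) (negate-difference a b) (∣m⇒∣-m m∣a-b))
    where
    negate-difference : ∀ a b → - (a - b) ≡ b - a
    negate-difference = solve-∀

  ≡mod-trans : ∀ {a b c} → a ≡ b mod m → b ≡ c mod m → a ≡ c mod m
  ≡mod-trans {a} {b} {c} (≡mod m∣a-b) (≡mod m∣b-c) =
    ≡mod (subst (m ∣_) (telescope a b c) (∣m∣n⇒∣m+n m∣a-b m∣b-c))
    where
    telescope : ∀ a b c → (a - b) + (b - c) ≡ a - c
    telescope = solve-∀

  +-cong-mod : ∀ {a b c d} → a ≡ c mod m → b ≡ d mod m → a + b ≡ c + d mod m
  +-cong-mod {a} {b} {c} {d} (≡mod m∣a-c) (≡mod m∣b-d) =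
    ≡mod (subst (m ∣_) (regroup a b c d) (∣m∣n⇒∣m+n m∣a-c m∣b-d))
    where
    regroup : ∀ a b c d → (a - c) + (b - d) ≡ (a + b) - (c + d)
    regroup = solve-∀

  *-cong-mod : ∀ {a b c d} → a ≡ c mod m → b ≡ d mod m → a * b ≡ c * d mod m
  *-cong-mod {a} {b} {c} {d} (≡mod m∣a-c) (≡mod m∣b-d) =
    ≡mod (subst (m ∣_) (regroup a b c d) (∣m∣n⇒∣m+n (∣n⇒∣m*n a m∣b-d) (∣m⇒∣m*n d m∣a-c)))
    where
    regroup : ∀ a b c d → a * (b - d) + (a - c) * d ≡ a * b - c * d
    regroup = solve-∀

  ^-cong-mod : ∀ {a b} n → a ≡ b mod m → a ^ n ≡ b ^ n mod m
  ^-cong-mod zero    a≡b = ≡mod-refl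
  ^-cong-mod (suc n) a≡b = *-cong-mod a≡b (^-cong-mod n a≡b)

  ∣⇒≡mod0 : ∀ {a} → m ∣ a → a ≡ 0ℤ mod m
  ∣⇒≡mod0 {a} m∣a = ≡mod (subst (m ∣_) (sym (+-identityʳ a)) m∣a)

  ≡mod-% : ∀ a .{{_ : NonZero m}} → a ≡ + (a % m) mod m
  ≡mod-% a = ≡mod (subst (m ∣_) (sym a-[a%m]≡[a/m]*m) (∣n⇒∣m*n (a / m) ∣-refl))
    where
    cancel : ∀ r t → (r + t) - r ≡ t
    cancel = solve-∀
    a-[a%m]≡[a/m]*m : a - + (a % m) ≡ (a / m) * m
    a-[a%m]≡[a/m]*m = trans (cong (_- + (a % m)) (a≡a%n+[a/n]*n a m))
                            (cancel (+ (a % m)) ((a / m) * m))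

≡mod-setoid : ℤ → Setoid 0ℓ 0ℓ
≡mod-setoid m = record
  { Carrier = ℤ
  ; _≈_ = λ a b → a ≡ b mod m
  ; isEquivalence = record { refl = ≡mod-refl ; sym = ≡mod-sym ; trans = ≡mod-trans }
  }

module ≡mod-Reasoning (m : ℤ) = Relation.Binary.Reasoning.Setoid (≡mod-setoid m)

pos-^ : ∀ n k → (+ n) ^ k ≡ + (n ℕ.^ k)
pos-^ n zero    = refl
pos-^ n (suc k) = trans (cong (+ n *_) (pos-^ n k)) (sym (pos-* n (n ℕ.^ k)))

euclidsLemmaℤ : ∀ {p} → Prime p → ∀ a b → + p ∣ a * b → (+ p ∣ a) ⊎ (+ p ∣ b)
euclidsLemmaℤ pr a b p∣ab with euclidsLemma ∣ a ∣ ∣ b ∣ pr (subst (ℕ._∣_ _) (abs-* a b) (∣⇒∣ᵤ p∣ab))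
... | inj₁ p∣a = inj₁ (∣ᵤ⇒∣ p∣a)
... | inj₂ p∣b = inj₂ (∣ᵤ⇒∣ p∣b)

*-cancelˡ-≡mod : ∀ {p a b c} → Prime p → ¬ (+ p ∣ a) → a * b ≡ a * c mod + p → b ≡ c mod + p
*-cancelˡ-≡mod {p} {a} {b} {c} pr p∤a (≡mod p∣ab-ac)
  with euclidsLemmaℤ pr a (b - c) (subst (+ p ∣_) (factor a b c) p∣ab-ac)
  where
  factor : ∀ a b c → a * b - a * c ≡ a * (b - c)
  factor = solve-∀
... | inj₁ p∣a   = ⊥-elim (p∤a p∣a)
... | inj₂ p∣b-c = ≡mod p∣b-c

fermatℕ : ∀ {p} → Prime p → ∀ n → + (n ℕ.^ p) ≡ + n mod + p
fermatℕ {suc q}     pr zero    = ≡mod-refl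
fermatℕ {p@(suc q)} pr (suc n) with freshmansDream pr 1 n
... | s , p∣s , dream = begin
  + (suc n ℕ.^ p)                 ≡⟨ cong +_ dream ⟩
  + (n ℕ.^ p ℕ.+ (s ℕ.+ 1 ℕ.^ p)) ≡⟨ cong (λ t → + (n ℕ.^ p ℕ.+ (s ℕ.+ t))) (ℕ.^-zeroˡ p) ⟩
  + (n ℕ.^ p) + (+ s + 1ℤ)        ≈⟨ +-cong-mod (fermatℕ pr n) (+-cong-mod s≡0 (≡mod-refl {a = 1ℤ})) ⟩
  + n + 1ℤ                        ≡⟨ cong +_ (ℕ.+-comm n 1) ⟩
  + suc n                         ∎
  where
  open ≡mod-Reasoning (+ p)
  s≡0 : + s ≡ 0ℤ mod + p
  s≡0 = ∣⇒≡mod0 (∣ᵤ⇒∣ p∣s)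

fermat : ∀ {p} → Prime p → ∀ a → a ^ p ≡ a mod + p
fermat {p@(suc q)} pr a = begin
  a ^ p       ≈⟨ ^-cong-mod p a≡r ⟩
  (+ r) ^ p   ≡⟨ pos-^ r p ⟩
  + (r ℕ.^ p) ≈⟨ fermatℕ pr r ⟩
  + r         ≈⟨ a≡r ⟨
  a           ∎
  where
  open ≡mod-Reasoning (+ p)
  r = a % + p
  a≡r : a ≡ + r mod + p
  a≡r = ≡mod-% a

fermat-unit : ∀ {p a} → Prime p → ¬ (+ p ∣ a) → a ^ (p ℕ.∸ 1) ≡ 1ℤ mod + p
fermat-unit {p@(suc q)} {a} pr p∤a = *-cancelˡ-≡mod pr p∤a (begin
  a * a ^ q ≈⟨ fermat pr a ⟩
  a         ≡⟨ *-identityʳ a ⟨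
  a * 1ℤ    ∎)
  where open ≡mod-Reasoning (+ p)

fermat-unit-^* : ∀ {p a} → Prime p → ¬ (+ p ∣ a) → ∀ t → a ^ (t ℕ.* (p ℕ.∸ 1)) ≡ 1ℤ mod + p
fermat-unit-^* {p} {a} pr p∤a t = begin
  a ^ (t ℕ.* (p ℕ.∸ 1))  ≡⟨ cong (a ^_) (ℕ.*-comm t (p ℕ.∸ 1)) ⟩
  a ^ ((p ℕ.∸ 1) ℕ.* t)  ≡⟨ ^-*-assoc a (p ℕ.∸ 1) t ⟨
  (a ^ (p ℕ.∸ 1)) ^ t    ≈⟨ ^-cong-mod t (fermat-unit pr p∤a) ⟩
  1ℤ ^ t                 ≡⟨ ^-zeroˡ t ⟩
  1ℤ                     ∎
  where open ≡mod-Reasoning (+ p)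

>⇒∤ℤ : ∀ {p n} → suc n ℕ.< p → ¬ (+ p ∣ + suc n)
>⇒∤ℤ n<p = ℕ.>⇒∤ n<p ∘ ∣⇒∣ᵤ

-- Polynomials are coefficient vectors, constant term first, so `last` is the leading coefficient.
eval : ∀ {n} → Vec ℤ n → ℤ → ℤ
eval []       x = 0ℤ
eval (c ∷ cs) x = c + x * eval cs x

-- Synthetic division of f by (x - r): the coefficients of the quotient.
quotientAt : ∀ {d} → ℤ → Vec ℤ (suc (suc d)) → Vec ℤ (suc d)
quotientAt {zero}  r (c ∷ c′ ∷ []) = c′ ∷ []
quotientAt {suc d} r (c ∷ cs)      = eval cs r ∷ quotientAt r cs

last-quotientAt : ∀ {d} r (f : Vec ℤ (suc (suc d))) → last (quotientAt r f) ≡ last f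
last-quotientAt {zero}  r (c ∷ c′ ∷ []) = refl
last-quotientAt {suc d} r (c ∷ cs)      = last-quotientAt r cs

eval-quotientAt : ∀ {d} r (f : Vec ℤ (suc (suc d))) x →
                eval f x ≡ eval f r + (x - r) * eval (quotientAt r f) x
eval-quotientAt {zero}  r (c ∷ c′ ∷ []) x = linear c c′ x r
  where
  linear : ∀ c c′ x r → c + x * (c′ + x * 0ℤ) ≡ (c + r * (c′ + r * 0ℤ)) + (x - r) * (c′ + x * 0ℤ)
  linear = solve-∀
eval-quotientAt {suc d} r (c ∷ cs) x =
  trans (cong (λ t → c + x * t) (eval-quotientAt r cs x))
        (step c x r (eval cs r) (eval (quotientAt r cs) x))
  where
  step : ∀ c x r g[r] q[x] →
         c + x * (g[r] + (x - r) * q[x]) ≡ (c + r * g[r]) + (x - r) * (g[r] + x * q[x])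
  step = solve-∀

-- Dividing f by x - s keeps the roots s + 1, …, s + d, as p divides none of 1, …, d.
lagrange-consecutive : ∀ {p d} → Prime p → d ℕ.< p → (f : Vec ℤ (suc d)) → ¬ (+ p ∣ last f) →
                       ∀ s → ¬ (∀ i → i ℕ.≤ d → + p ∣ eval f (s + + i))
lagrange-consecutive {p} {zero} pr _ (c ∷ []) p∤c s roots =
  p∤c (subst (+ p ∣_) (constant c (s + + 0)) (roots 0 z≤n))
  where
  constant : ∀ c x → c + x * 0ℤ ≡ c
  constant = solve-∀
lagrange-consecutive {p} {suc d} pr d<p f p∤lead s roots =
  lagrange-consecutive pr (ℕ.<-trans (ℕ.n<1+n d) d<p) (quotientAt s f)
    (p∤lead ∘ subst (+ p ∣_) (last-quotientAt s f)) (s + 1ℤ) quotient-roots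
  where
  shift : ∀ s y → s + (1ℤ + y) ≡ (s + 1ℤ) + y
  shift = solve-∀
  cancel : ∀ s y → (s + y) - s ≡ y
  cancel = solve-∀
  quotient-roots : ∀ i → i ℕ.≤ d → + p ∣ eval (quotientAt s f) ((s + 1ℤ) + + i)
  quotient-roots i i≤d = [ ⊥-elim ∘ >⇒∤ℤ (ℕ.≤-<-trans (s≤s i≤d) d<p)
                         , subst (λ x → + p ∣ eval (quotientAt s f) x) (shift s (+ i)) ]′
                         (euclidsLemmaℤ pr (+ suc i) (eval (quotientAt s f) x) p∣[1+i]*q)
    where
    x = s + + suc i
    f-root : + p ∣ eval f s
    f-root = subst (λ y → + p ∣ eval f y) (+-identityʳ s) (roots 0 z≤n)
    f[x]≡[1+i]*q : eval f x ≡ eval f s + + suc i * eval (quotientAt s f) x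
    f[x]≡[1+i]*q = trans (eval-quotientAt s f x)
                         (cong (λ y → eval f s + y * eval (quotientAt s f) x) (cancel s (+ suc i)))
    p∣[1+i]*q : + p ∣ + suc i * eval (quotientAt s f) x
    p∣[1+i]*q = ∣m+n∣m⇒∣n (subst (+ p ∣_) f[x]≡[1+i]*q (roots (suc i) (s≤s i≤d))) f-root

X^ : ∀ d → Vec ℤ (suc d)
X^ zero    = 1ℤ ∷ []
X^ (suc d) = 0ℤ ∷ X^ d

eval-X^ : ∀ d x → eval (X^ d) x ≡ x ^ d
eval-X^ zero    x = constant x
  where
  constant : ∀ x → 1ℤ + x * 0ℤ ≡ 1ℤ
  constant = solve-∀
eval-X^ (suc d) x = trans (+-identityˡ _) (cong (x *_) (eval-X^ d x))

last-X^ : ∀ d → last (X^ d) ≡ 1ℤ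
last-X^ zero    = refl
last-X^ (suc d) = last-X^ d

-- x ^ r - 1 has the r + 1 roots 1, …, r + 1 modulo p, one too many for its degree.
¬units-^≡1 : ∀ {p r} → Prime p → 0 ℕ.< r → r ℕ.< p ℕ.∸ 1 →
             ¬ (∀ a → ¬ (+ p ∣ a) → a ^ r ≡ 1ℤ mod + p)
¬units-^≡1 {suc q} {suc h} pr _ r<q units =
  lagrange-consecutive pr (ℕ.<-trans r<q (ℕ.n<1+n q)) X^r-1 p∤lead 1ℤ roots
  where
  X^r-1 : Vec ℤ (suc (suc h))
  X^r-1 = -1ℤ ∷ X^ h
  p∤lead : ¬ (+ suc q ∣ last X^r-1)
  p∤lead = subst (λ c → ¬ (+ suc q ∣ c)) (sym (last-X^ h)) (>⇒∤ℤ (s≤s (ℕ.≤-trans (s≤s z≤n) r<q)))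
  reorder : ∀ y → -1ℤ + y ≡ y - 1ℤ
  reorder = solve-∀
  roots : ∀ i → i ℕ.≤ suc h → + suc q ∣ eval X^r-1 (1ℤ + + i)
  roots i i≤r = subst (+ suc q ∣_) (sym eval≡)
    (∣-difference (units (+ suc i) (>⇒∤ℤ (s≤s (ℕ.≤-<-trans i≤r r<q)))))
    where
    x = 1ℤ + + i
    eval≡ : eval X^r-1 x ≡ x ^ suc h - 1ℤ
    eval≡ = trans (cong (λ y → -1ℤ + x * y) (eval-X^ h x)) (reorder (x ^ suc h))

units-^≡1⇒p∸1∣ : ∀ {p m} → Prime p → (∀ a → ¬ (+ p ∣ a) → a ^ m ≡ 1ℤ mod + p) → (p ℕ.∸ 1) ℕ.∣ m
units-^≡1⇒p∸1∣ {p@(suc (suc q))} {m} pr units with m ℕ.% suc q in m%q≡r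
... | zero  = ℕ.m%n≡0⇒n∣m m (suc q) m%q≡r
... | suc h = ⊥-elim (¬units-^≡1 pr z<s r<q units-^r)
  where
  r = suc h
  t = m ℕ./ suc q
  r<q : r ℕ.< suc q
  r<q = subst (ℕ._< suc q) m%q≡r (ℕ.m%n<n m (suc q))
  m≡r+t*q : m ≡ r ℕ.+ t ℕ.* suc q
  m≡r+t*q = trans (ℕ.m≡m%n+[m/n]*n m (suc q)) (cong (ℕ._+ t ℕ.* suc q) m%q≡r)
  units-^r : ∀ a → ¬ (+ p ∣ a) → a ^ r ≡ 1ℤ mod + p
  units-^r a p∤a = begin
    a ^ r                     ≡⟨ *-identityʳ (a ^ r) ⟨
    a ^ r * 1ℤ                ≈⟨ *-cong-mod (≡mod-refl {a = a ^ r}) (fermat-unit-^* pr p∤a t) ⟨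
    a ^ r * a ^ (t ℕ.* suc q) ≡⟨ ^-distribˡ-+-* a r (t ℕ.* suc q) ⟨
    a ^ (r ℕ.+ t ℕ.* suc q)   ≡⟨ cong (a ^_) m≡r+t*q ⟨
    a ^ m                     ≈⟨ units a p∤a ⟩
    1ℤ                        ∎
    where open ≡mod-Reasoning (+ p)

^suc≡⇒p∸1∣ : ∀ {p m} → Prime p → (∀ a → a ^ suc m ≡ a mod + p) → (p ℕ.∸ 1) ℕ.∣ m
^suc≡⇒p∸1∣ {p} {m} pr ^suc≡ = units-^≡1⇒p∸1∣ pr λ a p∤a → *-cancelˡ-≡mod pr p∤a (begin
  a * a ^ m ≈⟨ ^suc≡ a ⟩
  a         ≡⟨ *-identityʳ a ⟨
  a * 1ℤ    ∎)
  where open ≡mod-Reasoning (+ p)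

p∸1∣⇒^suc≡ : ∀ {p m} → Prime p → (p ℕ.∸ 1) ℕ.∣ m → ∀ a → a ^ suc m ≡ a mod + p
p∸1∣⇒^suc≡ {p} {m} pr (ℕ.divides t m≡t*[p∸1]) a with + p ∣? a
... | yes p∣a = begin
  a * a ^ m   ≈⟨ *-cong-mod a≡0 (≡mod-refl {a = a ^ m}) ⟩
  0ℤ * a ^ m  ≡⟨⟩
  0ℤ          ≈⟨ a≡0 ⟨
  a           ∎
  where
  open ≡mod-Reasoning (+ p)
  a≡0 : a ≡ 0ℤ mod + p
  a≡0 = ∣⇒≡mod0 p∣a
... | no p∤a = begin
  a * a ^ m                 ≡⟨ cong (λ e → a * a ^ e) m≡t*[p∸1] ⟩
  a * a ^ (t ℕ.* (p ℕ.∸ 1)) ≈⟨ *-cong-mod (≡mod-refl {a = a}) (fermat-unit-^* pr p∤a t) ⟩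
  a * 1ℤ                    ≡⟨ *-identityʳ a ⟩
  a                         ∎
  where open ≡mod-Reasoning (+ p)

prime>1 : ∀ {p} → Prime p → 1 ℕ.< p
prime>1 {p} pr = ℕ.nonTrivial⇒n>1 p {{prime⇒nonTrivial pr}}

-- p divides the cofactor of ∏ ps in x, since p ∣ ∏ ps would put p * p in the product.
squareFree-product∣ : ∀ {x} ps → All Prime ps → SquareFree (product ps) →
                      (∀ p → Prime p → p ℕ.∣ product ps → p ℕ.∣ x) → product ps ℕ.∣ x
squareFree-product∣ [] _ _ _ = ℕ.1∣ _
squareFree-product∣ {x} (p ∷ ps) (pr ∷ prs) sf primes∣x
  with squareFree-product∣ ps prs (λ d 1<d d²∣ps → sf d 1<d (ℕ.∣n⇒∣m*n p d²∣ps))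
                           (λ q pq q∣ps → primes∣x q pq (ℕ.∣n⇒∣m*n p q∣ps))
... | ℕ.divides y x≡y*ps
  with euclidsLemma y (product ps) pr (subst (p ℕ.∣_) x≡y*ps (primes∣x p pr (ℕ.m∣m*n (product ps))))
...   | inj₁ p∣y  = subst (p ℕ.* product ps ℕ.∣_) (sym x≡y*ps) (ℕ.*-monoˡ-∣ (product ps) p∣y)
...   | inj₂ p∣ps = ⊥-elim (sf p (prime>1 pr) (ℕ.*-monoʳ-∣ p p∣ps))

squareFree⇒∣ : ∀ {n x} .{{_ : ℕ.NonZero n}} → SquareFree n →
               (∀ p → Prime p → p ℕ.∣ n → p ℕ.∣ x) → n ℕ.∣ x
squareFree⇒∣ {n} sf primes∣x = subst (ℕ._∣ _) (sym n≡∏)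
  (squareFree-product∣ factors factorsPrime (subst SquareFree n≡∏ sf)
    (λ p pr p∣∏ → primes∣x p pr (subst (p ℕ.∣_) (sym n≡∏) p∣∏)))
  where
  open PrimeFactorisation (factorise n) renaming (isFactorisation to n≡∏)

-- With a = d, the square d * d divides both a ^ suc m and a ^ suc m - a, hence d itself.
^suc≡⇒squareFree : ∀ {n m} → 0 ℕ.< m → (∀ a → a ^ suc m ≡ a mod + n) → SquareFree n
^suc≡⇒squareFree {n} {suc m} _ ^suc≡ d 1<d d²∣n = ℕ.<⇒≱ (ℕ.m<m*n d d 1<d) (ℕ.∣⇒≤ (∣⇒∣ᵤ d²∣d))
  where
  instance
    _ = ℕ.>-nonZero (ℕ.<-trans z<s 1<d)
  a = + d
  d²∣a^suc-a : + (d ℕ.* d) ∣ a ^ suc (suc m) - a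
  d²∣a^suc-a = ∣-trans (∣ᵤ⇒∣ d²∣n) (∣-difference (^suc≡ a))
  d²∣a^suc : + (d ℕ.* d) ∣ a ^ suc (suc m)
  d²∣a^suc = divides (a ^ m) (begin
    a * (a * a ^ m) ≡⟨ *-assoc a a (a ^ m) ⟨
    (a * a) * a ^ m ≡⟨ *-comm (a * a) (a ^ m) ⟩
    a ^ m * (a * a) ≡⟨ cong (a ^ m *_) (pos-* d d) ⟨
    a ^ m * + (d ℕ.* d) ∎)
    where open ≡-Reasoning
  cancel : ∀ x y → x - (x - y) ≡ y
  cancel = solve-∀
  d²∣d : + (d ℕ.* d) ∣ a
  d²∣d = subst (+ (d ℕ.* d) ∣_) (cancel (a ^ suc (suc m)) a) (∣m∣n⇒∣m-n d²∣a^suc d²∣a^suc-a)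

corollary2p2 : (k : ℤ) (n : ℕ) → 0 ℕ.< n → k < + n →
    ((∀ (a : ℤ) → (+ n) ∣ᵤ ((a ^ suc ∣ (+ n) - k ∣) - a))
      ⇔ (SquareFree n × (∀ p → Prime p → p ℕ.∣ n → (+ (p ℕ.∸ 1)) ∣ᵤ ((+ n) - k))))
corollary2p2 k n 0<n k<n = mk⇔
  (λ n∣ → ^suc≡⇒squareFree 0<m (≡mod ∘ ∣ᵤ⇒∣ ∘ n∣)
        , λ p pr p∣n → ^suc≡⇒p∸1∣ pr (λ a → ≡mod (∣ᵤ⇒∣ (ℕ.∣-trans p∣n (n∣ a)))))
  (λ (sf , p∸1∣m) a → squareFree⇒∣ {{ℕ.>-nonZero 0<n}} sf
        (λ p pr p∣n → ∣⇒∣ᵤ (∣-difference (p∸1∣⇒^suc≡ pr (p∸1∣m p pr p∣n) a))))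
  where
  0<m : 0 ℕ.< ∣ + n - k ∣
  0<m = ℕ.n≢0⇒n>0 λ m≡0 → <-irrefl (sym (i-j≡0⇒i≡j (+ n) k (∣i∣≡0⇒i≡0 m≡0))) k<n
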